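{- Let $G$ be a minimal non-odd-transversal hypergraph all of whose edges have even size, with $n$ vertices and $m$ edges. Then: (1) $n\ge m$; (2) for every $1\le t\le m-1$, any $t$ distinct edges of $G$ have union containing at least $t+1$ vertices; (3) the incidence bipartite graph $\Gamma_G$ has a matching that covers every vertex of $\Gamma_G$ corresponding to an edge of $G$; i.e., there is an injection $f:E(G)\to V(G)$ with $f(e)\in e$ for all $e\in E(G)$.
   Context: A hypergraph $G=(V,E)$ has a finite vertex set and an edge set of distinct nonempty subsets of $V$, with no isolated vertices. A subset $U\subseteq V$ is an odd transversal if every edge meets $U$ in an odd number of vertices; $G$ is odd-transversal if it has an odd transversal; $G$ is minimal non-odd-transversal if it is not odd-transversal but $G-e$ (delete the edge $e$ from $E$) is odd-transversal for every edge $e$. The incidence bipartite graph $\Gamma_G$ is the simple bipartite graph with parts $V$ and $E$, where $v\in V$ and $e\in E$ are adjacent iff $v\in e$. -}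

module Defs where

open import Data.Nat using (ℕ; zero; suc; _%_)
open import Data.Bool using (Bool; true; false; if_then_else_)
open import Data.Vec using (Vec; []; _∷_)
open import Data.Fin using (Fin; zero; suc)
open import Data.Fin.Subset using (Subset; _∈_; _∉_; _∩_; _∪_; ⊥; ∣_∣; Nonempty)
open import Data.Product using (Σ; ∃; _×_)
open import Relation.Binary.PropositionalEquality using (_≡_; _≢_)
open import Relation.Nullary using (¬_)
open import Function.Definitions using (Injective)

record Hypergraph (n m : ℕ) : Set where
  field
    edge        : Fin m → Subset n
    distinct    : Injective _≡_ _≡_ edge
    nonemptyE   : ∀ e → Nonempty (edge e)
    noIsolated  : ∀ v → ∃ λ e → v ∈ edge e
open Hypergraph public

Odd : ℕ → Set
Odd k = k % 2 ≡ 1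

Even : ℕ → Set
Even k = k % 2 ≡ 0

IsOddTransversal : ∀ {n m} → Hypergraph n m → Subset n → Set
IsOddTransversal G U = ∀ e → Odd ∣ edge G e ∩ U ∣

OddTransversal : ∀ {n m} → Hypergraph n m → Set
OddTransversal {n} G = Σ (Subset n) λ U → IsOddTransversal G U

OddTransversalWithout : ∀ {n m} → Hypergraph n m → Fin m → Set
OddTransversalWithout {n} G e =
  Σ (Subset n) λ U → ∀ e′ → e′ ≢ e → Odd ∣ edge G e′ ∩ U ∣

MinimalNonOddTransversal : ∀ {n m} → Hypergraph n m → Set
MinimalNonOddTransversal {m = m} G =
  ¬ OddTransversal G × (∀ (e : Fin m) → OddTransversalWithout G e)

unionOf : ∀ {n m} → (Fin m → Subset n) → Subset m → Subset n
unionOf {m = zero}  E []      = ⊥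
unionOf {m = suc m} E (b ∷ S) =
  (if b then E zero else ⊥) ∪ unionOf (λ i → E (suc i)) S

-- Work over GF(2) with the incidence matrix M of G (rows are edges, columns vertices).
-- G has no odd transversal iff M x = 1 is unsolvable, so by the Fredholm alternative some
-- relation y M = 0 among the rows has y · 1 = 1.  Minimality says M x = 1 becomes solvable
-- after deleting any one equation, hence every relation vanishing on some edge is orthogonal
-- to 1; so the only nonzero relation is the all-ones vector.  As edges have even size, every
-- row sums to zero, so deleting a column loses no relation, and once a row is deleted too the
-- remaining rows are linearly independent.  Independent rows of a 0/1 matrix admit a system of
-- distinct representatives.  Deleting an edge e and a vertex v ∈ e gives the injection (3),
-- hence (1); deleting an edge outside a proper set S of edges and a vertex of their union U
-- matches S into U minus that vertex, which is (2).

module Submission where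

open import Algebra.Bundles using (CommutativeRing)
open import Data.Bool using (Bool; true; false; not; _∧_; _xor_; if_then_else_)
open import Data.Bool.Properties
  using ( xor-∧-commutativeRing; ∧-distribʳ-xor; ∧-assoc; ∧-comm; ∧-zeroʳ; ∧-identityʳ
        ; ∧-conicalˡ; ∧-conicalʳ; xor-identityʳ; xor-same; ¬-not; not-injective)
  renaming (_≟_ to _≟ᵇ_)
open import Data.Bool.Solver using (module xor-∧-Solver)
open import Data.Empty using (⊥-elim)
open import Data.Fin using (Fin; zero; suc; punchIn; punchOut)
open import Data.Fin.Properties
  using ( _≟_; any?; all?; suc-injective; 0≢1+n; injective⇒≤
        ; punchIn-injective; punchInᵢ≢i; punchIn-punchOut)
open import Data.Fin.Subset using (Subset; ∣_∣; _∩_; _∈_; _∉_; _-_; ∁; Nonempty)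
open import Data.Fin.Subset.Properties
  using ( anySubset?; ∣∁p∣≡n∸∣p∣; x∈∁p⇒x∉p; p⊆p∪q; q⊆p∪q
        ; x∈p∧x≢y⇒x∈p-y; x∈p⇒∣p-x∣<∣p∣)
open import Data.Nat using (ℕ; zero; suc; _%_; _∸_; _≤_; _<_; z≤n; s≤s)
open import Data.Nat.Properties using (≤-trans; m<n⇒0<n∸m; 1+n≢0)
import Data.Product as Product
open import Data.Product using (Σ; ∃; _×_; _,_; proj₁; proj₂)
open import Data.Sum as Sum using (_⊎_; inj₁; inj₂)
open import Data.Vec using (lookup; tabulate; []; _∷_; here; there)
open import Data.Vec.Functional as V using (Vector; zipWith; replicate; map; removeAt)
open import Data.Vec.Properties using (lookup∘tabulate; lookup-zipWith; []=⇒lookup; lookup⇒[]=)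
open import Function using (_∘_)
open import Function.Definitions using (Injective)
open import Relation.Binary.PropositionalEquality
open import Relation.Nullary using (¬_; Dec; does; yes; no)
import Relation.Nullary.Decidable as Dec
open import Relation.Nullary.Decidable using (dec-true; dec-false; _→-dec_; _×-dec_)

open import Defs

open ≡-Reasoning
open xor-∧-Solver using (solve; _:=_; _:+_; _:*_)
open CommutativeRing xor-∧-commutativeRing using (semiring)
open import Algebra.Properties.Semiring.Sum semiring
  using ( sum; sum-syntax; sum-cong-≗; sum-replicate-zero; sum-remove
        ; ∑-distrib-+; ∑-comm; *-distribˡ-sum; *-distribʳ-sum)

private
  variable
    m n : ℕ

true≢false : true ≢ false
true≢false ()

Matrix : ℕ → ℕ → Set
Matrix m n = Fin m → Fin n → Bool

0ᵥ : Vector Bool n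
0ᵥ = replicate _ false

1ᵥ : Vector Bool n
1ᵥ = replicate _ true

infixl 6 _⊕_
_⊕_ : Vector Bool n → Vector Bool n → Vector Bool n
_⊕_ = zipWith _xor_

unit : Fin n → Vector Bool n
unit p i = does (i ≟ p)

infixr 7 _*ₛ_
_*ₛ_ : Bool → Vector Bool n → Vector Bool n
c *ₛ x = map (c ∧_) x

infix 7 _·_
_·_ : Vector Bool n → Vector Bool n → Bool
x · y = sum (zipWith _∧_ x y)

_*ᵥ_ : Matrix m n → Vector Bool n → Vector Bool m
(M *ᵥ x) i = M i · x

_ᵥ*_ : Vector Bool m → Matrix m n → Vector Bool n
(y ᵥ* M) j = y · λ i → M i j

removeColumn : Fin (suc n) → Matrix m (suc n) → Matrix m n
removeColumn u M i = removeAt (M i) u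

sum-0ᵥ : ∀ {x : Vector Bool n} → x ≗ 0ᵥ → sum x ≡ false
sum-0ᵥ {n} x≗0 = trans (sum-cong-≗ x≗0) (sum-replicate-zero n)

sum≡true⇒∃ : (x : Vector Bool n) → sum x ≡ true → ∃ λ i → x i ≡ true
sum≡true⇒∃ {suc n} x sum≡true with x zero in x₀
... | true  = zero , x₀
... | false with sum≡true⇒∃ (x ∘ suc) sum≡true
...   | i , xᵢ = suc i , xᵢ

·-comm : (x y : Vector Bool n) → x · y ≡ y · x
·-comm x y = sum-cong-≗ (λ i → ∧-comm (x i) (y i))

·-congˡ : {x y : Vector Bool n} (z : Vector Bool n) → x ≗ y → x · z ≡ y · z
·-congˡ z x≗y = sum-cong-≗ (λ i → cong (_∧ z i) (x≗y i))

·-congʳ : (x : Vector Bool n) {y z : Vector Bool n} → y ≗ z → x · y ≡ x · z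
·-congʳ x y≗z = sum-cong-≗ (λ i → cong (x i ∧_) (y≗z i))

·-0ᵥ : (x : Vector Bool n) → x · 0ᵥ ≡ false
·-0ᵥ x = sum-0ᵥ (λ i → ∧-zeroʳ (x i))

·-⊕ˡ : (x y z : Vector Bool n) → (x ⊕ y) · z ≡ x · z xor y · z
·-⊕ˡ x y z = trans (sum-cong-≗ (λ i → ∧-distribʳ-xor (z i) (x i) (y i)))
                   (∑-distrib-+ (zipWith _∧_ x z) (zipWith _∧_ y z))

·-⊕ʳ : (x y z : Vector Bool n) → x · (y ⊕ z) ≡ x · y xor x · z
·-⊕ʳ x y z = begin
  x · (y ⊕ z)        ≡⟨ ·-comm x (y ⊕ z) ⟩
  (y ⊕ z) · x        ≡⟨ ·-⊕ˡ y z x ⟩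
  y · x xor z · x    ≡⟨ cong₂ _xor_ (·-comm y x) (·-comm z x) ⟩
  x · y xor x · z    ∎

·-*ₛˡ : (c : Bool) (x y : Vector Bool n) → (c *ₛ x) · y ≡ c ∧ x · y
·-*ₛˡ c x y =
  trans (sum-cong-≗ (λ i → ∧-assoc c (x i) (y i))) (sym (*-distribˡ-sum c (zipWith _∧_ x y)))

·-*ₛʳ : (x : Vector Bool n) (c : Bool) (y : Vector Bool n) → x · (c *ₛ y) ≡ c ∧ x · y
·-*ₛʳ x c y = trans (·-comm x (c *ₛ y)) (trans (·-*ₛˡ c y x) (cong (c ∧_) (·-comm y x)))

unit-· : (p : Fin n) (x : Vector Bool n) → unit p · x ≡ x p
unit-· {suc n} zero    x = trans (cong (x zero xor_) (sum-replicate-zero n)) (xor-identityʳ (x zero))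
unit-·         (suc p) x = unit-· p (x ∘ suc)

·-*ᵥ : (y : Vector Bool m) (M : Matrix m n) (x : Vector Bool n) → y · (M *ᵥ x) ≡ (y ᵥ* M) · x
·-*ᵥ {m} {n} y M x = begin
  ∑[ i < m ] (y i ∧ ∑[ j < n ] (M i j ∧ x j))
    ≡⟨ sum-cong-≗ (λ i → *-distribˡ-sum (y i) (λ j → M i j ∧ x j)) ⟩
  ∑[ i < m ] ∑[ j < n ] (y i ∧ (M i j ∧ x j))
    ≡⟨ ∑-comm (λ i j → y i ∧ (M i j ∧ x j)) ⟩
  ∑[ j < n ] ∑[ i < m ] (y i ∧ (M i j ∧ x j))
    ≡⟨ sum-cong-≗ (λ j → sum-cong-≗ (λ i → ∧-assoc (y i) (M i j) (x j))) ⟨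
  ∑[ j < n ] ∑[ i < m ] ((y i ∧ M i j) ∧ x j)
    ≡⟨ sum-cong-≗ (λ j → *-distribʳ-sum (x j) (λ i → y i ∧ M i j)) ⟨
  ∑[ j < n ] ((y ᵥ* M) j ∧ x j)
    ∎

-- The Fredholm alternative

Solvable : Matrix m n → Vector Bool m → Set
Solvable M b = ∃ λ x → M *ᵥ x ≗ b

Dependency : Matrix m n → Vector Bool m → Set
Dependency M y = y ᵥ* M ≗ 0ᵥ

ᵥ*-⊕ : (x y : Vector Bool m) (M : Matrix m n) → (x ⊕ y) ᵥ* M ≗ x ᵥ* M ⊕ y ᵥ* M
ᵥ*-⊕ x y M j = ·-⊕ˡ x y (λ i → M i j)

dependency-⊕ : {M : Matrix m n} {x y : Vector Bool m} →
               Dependency M x → Dependency M y → Dependency M (x ⊕ y)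
dependency-⊕ {M = M} {x} {y} depx depy j = trans (ᵥ*-⊕ x y M j) (cong₂ _xor_ (depx j) (depy j))

dependency-extend : (M : Matrix m (suc n)) {z : Vector Bool m} →
                    (z ᵥ* M) zero ≡ false → Dependency (removeColumn zero M) z → Dependency M z
dependency-extend M z₀ dep zero    = z₀
dependency-extend M z₀ dep (suc j) = dep j

Inconsistent : Matrix m n → Vector Bool m → Set
Inconsistent M b = ∃ λ y → Dependency M y × y · b ≡ true

-- Gaussian elimination on column 0 with pivot row p: row i becomes row i + M i 0 · row p.
-- A solution of the reduced system extends by solving equation p for x 0; a certificate y of
-- the reduced system becomes the certificate lift y, since lift y · v = y · reduce v.
module Elimination (M : Matrix m (suc n)) (p : Fin m) (pivot : M p zero ≡ true) where

  column₀ : Vector Bool m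
  column₀ i = M i zero

  M⁺ : Matrix m n
  M⁺ = removeColumn zero M

  reduce : Vector Bool m → Vector Bool m
  reduce v = v ⊕ v p *ₛ column₀

  reduced : Matrix m n
  reduced i j = reduce (λ k → M⁺ k j) i

  reduce-column₀ : reduce column₀ ≗ 0ᵥ
  reduce-column₀ i = trans (cong (λ c → column₀ i xor c ∧ column₀ i) pivot) (xor-same (column₀ i))

  reduce-*ᵥ : (x : Vector Bool n) → reduce (M⁺ *ᵥ x) ≗ reduced *ᵥ x
  reduce-*ᵥ x i = begin
    M⁺ i · x xor (M⁺ p · x) ∧ column₀ i
      ≡⟨ cong (M⁺ i · x xor_) (∧-comm (M⁺ p · x) (column₀ i)) ⟩
    M⁺ i · x xor column₀ i ∧ M⁺ p · x
      ≡⟨ cong (M⁺ i · x xor_) (·-*ₛˡ (column₀ i) (M⁺ p) x) ⟨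
    M⁺ i · x xor (column₀ i *ₛ M⁺ p) · x
      ≡⟨ ·-⊕ˡ (M⁺ i) (column₀ i *ₛ M⁺ p) x ⟨
    (M⁺ i ⊕ column₀ i *ₛ M⁺ p) · x
      ≡⟨ ·-congˡ x (λ j → cong (M⁺ i j xor_) (∧-comm (column₀ i) (M⁺ p j))) ⟩
    reduced i · x
      ∎

  lift : Vector Bool m → Vector Bool m
  lift y = y ⊕ (y · column₀) *ₛ unit p

  lift-· : (y v : Vector Bool m) → lift y · v ≡ y · reduce v
  lift-· y v = begin
    lift y · v
      ≡⟨ ·-⊕ˡ y ((y · column₀) *ₛ unit p) v ⟩
    y · v xor ((y · column₀) *ₛ unit p) · v
      ≡⟨ cong (y · v xor_) (·-*ₛˡ (y · column₀) (unit p) v) ⟩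
    y · v xor (y · column₀) ∧ unit p · v
      ≡⟨ cong (λ c → y · v xor (y · column₀) ∧ c) (unit-· p v) ⟩
    y · v xor (y · column₀) ∧ v p
      ≡⟨ cong (y · v xor_) (∧-comm (y · column₀) (v p)) ⟩
    y · v xor v p ∧ y · column₀
      ≡⟨ cong (y · v xor_) (·-*ₛʳ y (v p) column₀) ⟨
    y · v xor y · (v p *ₛ column₀)
      ≡⟨ ·-⊕ʳ y v (v p *ₛ column₀) ⟨
    y · reduce v
      ∎

  solvable : ∀ {b} → Solvable reduced (reduce b) → Solvable M b
  solvable {b} (x , sol) = (b p xor (M⁺ *ᵥ x) p) V.∷ x , λ i → begin
    column₀ i ∧ (b p xor A p) xor A i
      ≡⟨ expand (column₀ i) (b p) (A p) (A i) ⟩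
    b p ∧ column₀ i xor (A i xor A p ∧ column₀ i)
      ≡⟨ cong (b p ∧ column₀ i xor_) (trans (reduce-*ᵥ x i) (sol i)) ⟩
    b p ∧ column₀ i xor (b i xor b p ∧ column₀ i)
      ≡⟨ cancel (b p ∧ column₀ i) (b i) ⟩
    b i
      ∎
    where
    A : Vector Bool m
    A = M⁺ *ᵥ x
    expand : ∀ h c a d → h ∧ (c xor a) xor d ≡ c ∧ h xor (d xor a ∧ h)
    expand = solve 4 (λ h c a d → h :* (c :+ a) :+ d := c :* h :+ (d :+ a :* h)) refl
    cancel : ∀ a d → a xor (d xor a) ≡ d
    cancel = solve 2 (λ a d → a :+ (d :+ a) := d) refl

  inconsistent : ∀ {b} → Inconsistent reduced (reduce b) → Inconsistent M b
  inconsistent {b} (y , dep , y·b) =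
    lift y , dependency-extend M lift-y₀ (λ j → trans (lift-· y _) (dep j)) , trans (lift-· y b) y·b
    where
    lift-y₀ : lift y · column₀ ≡ false
    lift-y₀ = trans (lift-· y column₀) (trans (·-congʳ y reduce-column₀) (·-0ᵥ y))

module ZeroColumn (M : Matrix m (suc n)) (zero-column : ∀ i → M i zero ≡ false) where

  M⁺ : Matrix m n
  M⁺ = removeColumn zero M

  solvable : ∀ {b} → Solvable M⁺ b → Solvable M b
  solvable (x , sol) = false V.∷ x , λ i → trans (cong (_xor M⁺ i · x) (∧-zeroʳ (M i zero))) (sol i)

  inconsistent : ∀ {b} → Inconsistent M⁺ b → Inconsistent M b
  inconsistent (y , dep , y·b) =
    y , dependency-extend M (trans (·-congʳ y zero-column) (·-0ᵥ y)) dep , y·b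

solvable⊎inconsistent : (M : Matrix m n) (b : Vector Bool m) → Solvable M b ⊎ Inconsistent M b
solvable⊎inconsistent {n = zero} M b with any? (λ i → b i ≟ᵇ true)
... | yes (p , bₚ) = inj₂ (unit p , (λ ()) , trans (unit-· p b) bₚ)
... | no  ∄bᵢ     = inj₁ ((λ ()) , λ i → sym (¬-not (∄bᵢ ∘ (i ,_))))
solvable⊎inconsistent {n = suc n} M b with any? (λ i → M i zero ≟ᵇ true)
... | yes (p , pivot) = Sum.map solvable inconsistent (solvable⊎inconsistent reduced (reduce b))
  where open Elimination M p pivot
... | no  ∄pivot     = Sum.map solvable inconsistent (solvable⊎inconsistent M⁺ b)
  where open ZeroColumn M (λ i → ¬-not (∄pivot ∘ (i ,_)))

-- Independent rows admit a matching

infix 4 _⊆_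
_⊆_ : Vector Bool m → Vector Bool m → Set
x ⊆ y = ∀ i → x i ≡ true → y i ≡ true

Independent : Matrix m n → Vector Bool m → Set
Independent M S = ∀ z → z ⊆ S → Dependency M z → z ≗ 0ᵥ

NonzeroDependency : Matrix m n → Vector Bool m → Set
NonzeroDependency M S = ∃ λ z → z ⊆ S × Dependency M z × ∃ λ i → z i ≡ true

¬nonzeroDependency⇒independent : {M : Matrix m n} {S : Vector Bool m} →
                                 ¬ NonzeroDependency M S → Independent M S
¬nonzeroDependency⇒independent ∄z z z⊆S dep i = ¬-not (λ zᵢ → ∄z (z , z⊆S , dep , i , zᵢ))

nonzeroDependency? : (M : Matrix m n) (S : Vector Bool m) → Dec (NonzeroDependency M S)
nonzeroDependency? M S = Dec.map′
  (λ (z , nz) → lookup z , nz)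
  (λ (z , z⊆S , dep , i , zᵢ) → tabulate z ,
     (λ k → z⊆S k ∘ trans (sym (lookup∘tabulate z k))) ,
     (λ j → trans (·-congˡ _ (lookup∘tabulate z)) (dep j)) ,
     i , trans (lookup∘tabulate z i) zᵢ)
  (anySubset? λ z → all? (λ i → (lookup z i ≟ᵇ true) →-dec (S i ≟ᵇ true))
                    ×-dec all? (λ j → (lookup z ᵥ* M) j ≟ᵇ false)
                    ×-dec any? (λ i → lookup z i ≟ᵇ true))

record Matching (M : Matrix m n) (S : Vector Bool m) : Set where
  field
    match           : ∀ i → S i ≡ true → Fin n
    match-∈         : ∀ i s → M i (match i s) ≡ true
    match-injective : ∀ {i j} s t → match i s ≡ match j t → i ≡ j

delete : Fin m → Vector Bool m → Vector Bool m
delete e S i = S i ∧ not (unit e i)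

delete-⊆ : (e : Fin m) (S : Vector Bool m) → delete e S ⊆ S
delete-⊆ e S i = ∧-conicalˡ (S i) _

delete-∉ : (e : Fin m) (S : Vector Bool m) → delete e S e ≡ false
delete-∉ e S = trans (cong (λ b → S e ∧ not b) (dec-true (e ≟ e) refl)) (∧-zeroʳ (S e))

delete-∈ : {S : Vector Bool m} {i e : Fin m} → S i ≡ true → i ≢ e → delete e S i ≡ true
delete-∈ {i = i} {e} Sᵢ i≢e = cong₂ (λ a b → a ∧ not b) Sᵢ (dec-false (i ≟ e) i≢e)

Avoids : {M : Matrix m n} {S : Vector Bool m} → Matching M S → Fin n → Set
Avoids mt u = ∀ i s → Matching.match mt i s ≢ u

module _ {M : Matrix m (suc n)} {S : Vector Bool m} (u : Fin (suc n))
         (mt : Matching (removeColumn u M) S) where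
  open Matching mt

  matching-removeColumn : Matching M S
  matching-removeColumn = record
    { match           = λ i s → punchIn u (match i s)
    ; match-∈         = match-∈
    ; match-injective = λ s t → match-injective s t ∘ punchIn-injective u _ _
    }

  matching-removeColumn-avoids : Avoids matching-removeColumn u
  matching-removeColumn-avoids i s = punchInᵢ≢i u (match i s)

module _ {M : Matrix m n} {S : Vector Bool m} {e : Fin m} {u : Fin n} (Mₑᵤ : M e u ≡ true)
         (mt : Matching M (delete e S)) (avoids : Avoids mt u) where
  open Matching mt

  private
    pick : ∀ i → S i ≡ true → Dec (i ≡ e) → Fin n
    pick i s (yes _)  = u
    pick i s (no i≢e) = match i (delete-∈ {S = S} s i≢e)

    pick-∈ : ∀ i s d → M i (pick i s d) ≡ true
    pick-∈ i s (yes refl) = Mₑᵤ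
    pick-∈ i s (no _)     = match-∈ i _

    pick-injective : ∀ {i j} s t di dj → pick i s di ≡ pick j t dj → i ≡ j
    pick-injective s t (yes refl) (yes refl) _  = refl
    pick-injective s t (yes _)    (no _)     eq = ⊥-elim (avoids _ _ (sym eq))
    pick-injective s t (no _)     (yes _)    eq = ⊥-elim (avoids _ _ eq)
    pick-injective s t (no _)     (no _)     eq = match-injective _ _ eq

  matching-insert : Matching M S
  matching-insert = record
    { match           = λ i s → pick i s (i ≟ e)
    ; match-∈         = λ i s → pick-∈ i s (i ≟ e)
    ; match-injective = λ {i} {j} s t → pick-injective s t (i ≟ e) (j ≟ e)
    }

empty-matching : {M : Matrix m n} {S : Vector Bool m} → S ≗ 0ᵥ → Matching M S
empty-matching {S = S} S≗0 = record
  { match           = λ i s → ⊥-elim (S∌ i s)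
  ; match-∈         = λ i s → ⊥-elim (S∌ i s)
  ; match-injective = λ {i} s _ _ → ⊥-elim (S∌ i s)
  }
  where
  S∌ : ∀ i → S i ≢ true
  S∌ i s = true≢false (trans (sym s) (S≗0 i))

⊆-trans : {x y z : Vector Bool m} → x ⊆ y → y ⊆ z → x ⊆ z
⊆-trans x⊆y y⊆z i = y⊆z i ∘ x⊆y i

⊕-⊆ : {x y S : Vector Bool m} → x ⊆ S → y ⊆ S → x ⊕ y ⊆ S
⊕-⊆ {x = x} x⊆S y⊆S i with x i in xᵢ
... | true  = λ _ → x⊆S i xᵢ
... | false = y⊆S i

module _ {M : Matrix m (suc n)} {S : Vector Bool m} (indep : Independent M S) where

  leading-entry : ∀ {z i} → z ⊆ S → Dependency (removeColumn zero M) z → z i ≡ true →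
                  (z ᵥ* M) zero ≡ true
  leading-entry {z} {i} z⊆S dep zᵢ =
    ¬-not λ z₀ → true≢false (trans (sym zᵢ) (indep z z⊆S (dependency-extend M z₀ dep) i))

  -- If z′ also had leading entry 1, then z ⊕ z′ would be a relation of M inside S that is
  -- nonzero at e, because z′ vanishes at e.
  exchange : ∀ {z e} → z ⊆ S → Dependency (removeColumn zero M) z → z e ≡ true →
             Independent (removeColumn zero M) (delete e S)
  exchange {z} {e} z⊆S dep zₑ z′ z′⊆S-e dep′ with (z′ ᵥ* M) zero in z′₀
  ... | false = indep z′ z′⊆S (dependency-extend M z′₀ dep′)
    where
    z′⊆S : z′ ⊆ S
    z′⊆S = ⊆-trans z′⊆S-e (delete-⊆ e S)
  ... | true  = ⊥-elim (true≢false (trans (sym (z′⊆S-e e z′ₑ)) (delete-∉ e S)))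
    where
    agree : z ᵥ* M ≗ z′ ᵥ* M
    agree zero    = trans (leading-entry z⊆S dep zₑ) (sym z′₀)
    agree (suc j) = trans (dep j) (sym (dep′ j))
    z⊕z′≗0 : z ⊕ z′ ≗ 0ᵥ
    z⊕z′≗0 = indep (z ⊕ z′) (⊕-⊆ z⊆S (⊆-trans z′⊆S-e (delete-⊆ e S))) λ j → begin
      ((z ⊕ z′) ᵥ* M) j                  ≡⟨ ᵥ*-⊕ z z′ M j ⟩
      (z ᵥ* M) j xor (z′ ᵥ* M) j         ≡⟨ cong (_xor (z′ ᵥ* M) j) (agree j) ⟩
      (z′ ᵥ* M) j xor (z′ ᵥ* M) j        ≡⟨ xor-same ((z′ ᵥ* M) j) ⟩
      false                              ∎
    z′ₑ : z′ e ≡ true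
    z′ₑ = not-injective (trans (cong (_xor z′ e) (sym zₑ)) (z⊕z′≗0 e))

-- If S stays independent without column 0, column 0 is not used.
-- Otherwise a relation z of the other columns has leading entry 1, so some row e ∈ z meets
-- column 0; e is matched to column 0, and S minus e stays independent by exchange.
independent⇒matching : (M : Matrix m n) (S : Vector Bool m) → Independent M S → Matching M S
independent⇒matching {n = zero}  M S indep = empty-matching (indep S (λ _ s → s) (λ ()))
independent⇒matching {n = suc n} M S indep with nonzeroDependency? (removeColumn zero M) S
... | no ∄z = matching-removeColumn zero
  (independent⇒matching (removeColumn zero M) S (¬nonzeroDependency⇒independent ∄z))
... | yes (z , z⊆S , dep , i , zᵢ)
    with sum≡true⇒∃ (zipWith _∧_ z (λ k → M k zero)) (leading-entry indep z⊆S dep zᵢ)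
...   | e , zₑ∧Mₑ₀ = matching-insert (∧-conicalʳ (z e) _ zₑ∧Mₑ₀)
                       (matching-removeColumn zero mt) (matching-removeColumn-avoids {M = M} zero mt)
  where
  mt : Matching (removeColumn zero M) (delete e S)
  mt = independent⇒matching _ (delete e S) (exchange indep z⊆S dep (∧-conicalˡ (z e) _ zₑ∧Mₑ₀))

-- Minimally unsolvable systems

-- As every row sums to zero, so do the entries of z ᵥ* M; the entry of a deleted column is
-- thus determined by the others.
dependency-removeColumn : {M : Matrix m (suc n)} → M *ᵥ 1ᵥ ≗ 0ᵥ →
                          (u : Fin (suc n)) {z : Vector Bool m} → Dependency (removeColumn u M) z → Dependency M z
dependency-removeColumn {M = M} rows-even u {z} dep j with j ≟ u
... | yes refl = begin
  (z ᵥ* M) u                                   ≡⟨ xor-identityʳ _ ⟨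
  (z ᵥ* M) u xor false                         ≡⟨ cong ((z ᵥ* M) u xor_) (sum-0ᵥ dep) ⟨
  (z ᵥ* M) u xor sum (removeAt (z ᵥ* M) u)     ≡⟨ sum-remove (z ᵥ* M) ⟨
  sum (z ᵥ* M)                                 ≡⟨ sum-cong-≗ (λ k → ∧-identityʳ ((z ᵥ* M) k)) ⟨
  (z ᵥ* M) · 1ᵥ                                ≡⟨ ·-*ᵥ z M 1ᵥ ⟨
  z · (M *ᵥ 1ᵥ)                                ≡⟨ ·-congʳ z rows-even ⟩
  z · 0ᵥ                                       ≡⟨ ·-0ᵥ z ⟩
  false                                        ∎
... | no j≢u =
  trans (cong (z ᵥ* M) (sym (punchIn-punchOut (j≢u ∘ sym)))) (dep (punchOut (j≢u ∘ sym)))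

SolvableWithout : Matrix m n → Vector Bool m → Fin m → Set
SolvableWithout M b e = ∃ λ x → ∀ i → i ≢ e → (M *ᵥ x) i ≡ b i

MinimallyUnsolvable : Matrix m n → Vector Bool m → Set
MinimallyUnsolvable M b = ¬ Solvable M b × (∀ e → SolvableWithout M b e)

module MinimallyUnsolvable {M : Matrix m n} {b : Vector Bool m}
                           (minimal : MinimallyUnsolvable M b) where

  dependency-⊥ : ∀ {z e} → Dependency M z → z e ≡ false → z · b ≡ false
  dependency-⊥ {z} {e} dep zₑ with proj₂ minimal e
  ... | x , sol = begin
    z · b             ≡⟨ sum-cong-≗ agree ⟩
    z · (M *ᵥ x)      ≡⟨ ·-*ᵥ z M x ⟩
    (z ᵥ* M) · x      ≡⟨ ·-congˡ x dep ⟩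
    0ᵥ · x            ≡⟨ sum-replicate-zero n ⟩
    false             ∎
    where
    agree : ∀ i → z i ∧ b i ≡ z i ∧ (M *ᵥ x) i
    agree i with i ≟ e
    ... | yes refl rewrite zₑ = refl
    ... | no i≢e   = cong (z i ∧_) (sym (sol i i≢e))

  -- The Fredholm alternative provides some certificate; by dependency-⊥ it has no zero entry.
  all-ones-certificate : Dependency M 1ᵥ × 1ᵥ · b ≡ true
  all-ones-certificate with solvable⊎inconsistent M b
  ... | inj₁ solvable        = ⊥-elim (proj₁ minimal solvable)
  ... | inj₂ (y , dep , y·b) =
    (λ j → trans (·-congˡ (λ i → M i j) y≗1) (dep j)) , trans (·-congˡ b y≗1) y·b
    where
    y≗1 : 1ᵥ ≗ y
    y≗1 i = sym (¬-not (λ yᵢ → true≢false (trans (sym y·b) (dependency-⊥ dep yᵢ))))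

  dependency-trivial : ∀ {z e} → Dependency M z → z e ≡ false → z ≗ 0ᵥ
  dependency-trivial {z} {e} dep zₑ i = ¬-not λ zᵢ → true≢false (begin
    true              ≡⟨ cong₂ _xor_ (proj₂ all-ones-certificate) (dependency-⊥ dep zₑ) ⟨
    1ᵥ · b xor z · b  ≡⟨ ·-⊕ˡ 1ᵥ z b ⟨
    (1ᵥ ⊕ z) · b      ≡⟨ dependency-⊥ (dependency-⊕ {M = M} (proj₁ all-ones-certificate) dep) (cong not zᵢ) ⟩
    false             ∎)

avoiding-matching : {M : Matrix m n} {b : Vector Bool m} → MinimallyUnsolvable M b → M *ᵥ 1ᵥ ≗ 0ᵥ →
                    {S : Vector Bool m} {e : Fin m} → S e ≡ false →
                    (u : Fin n) → Σ (Matching M S) λ mt → Avoids mt u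
avoiding-matching {n = zero}                                      _ _ _  ()
avoiding-matching {n = suc n} {M = M} minimal rows-even {S} {e} Sₑ u =
  matching-removeColumn u mt , matching-removeColumn-avoids {M = M} u mt
  where
  open MinimallyUnsolvable {M = M} minimal
  independent : Independent (removeColumn u M) S
  independent z z⊆S dep = dependency-trivial (dependency-removeColumn {M = M} rows-even u dep)
                            (¬-not λ zₑ → true≢false (trans (sym (z⊆S e zₑ)) Sₑ))
  mt : Matching (removeColumn u M) S
  mt = independent⇒matching (removeColumn u M) S independent

-- Hypergraphs

∣∣%2 : (A : Subset n) → ∣ A ∣ % 2 ≡ (if sum (lookup A) then 1 else 0)
∣∣%2 []          = refl
∣∣%2 (false ∷ A) = ∣∣%2 A
∣∣%2 (true  ∷ A) = suc-%2 ∣ A ∣ (sum (lookup A)) (∣∣%2 A)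
  where
  suc-%2 : ∀ k b → k % 2 ≡ (if b then 1 else 0) → suc k % 2 ≡ (if not b then 1 else 0)
  suc-%2 zero          false _  = refl
  suc-%2 (suc zero)    true  _  = refl
  suc-%2 (suc (suc k)) b     eq = suc-%2 k b eq

odd⇒sum≡true : (A : Subset n) → Odd ∣ A ∣ → sum (lookup A) ≡ true
odd⇒sum≡true A odd with sum (lookup A) | ∣∣%2 A
... | true  | _  = refl
... | false | eq = ⊥-elim (1+n≢0 (trans (sym odd) eq))

sum≡true⇒odd : (A : Subset n) → sum (lookup A) ≡ true → Odd ∣ A ∣
sum≡true⇒odd A sum≡true = trans (∣∣%2 A) (cong (if_then 1 else 0) sum≡true)

even⇒sum≡false : (A : Subset n) → Even ∣ A ∣ → sum (lookup A) ≡ false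
even⇒sum≡false A even = ¬-not λ sum≡true → 1+n≢0 (trans (sym (sum≡true⇒odd A sum≡true)) even)

incidence : Hypergraph n m → Matrix m n
incidence G e v = lookup (edge G e) v

module _ (G : Hypergraph n m) where

  sum-edge∩ : ∀ e (U : Subset n) → sum (lookup (edge G e ∩ U)) ≡ incidence G e · lookup U
  sum-edge∩ e U = sum-cong-≗ (λ v → lookup-zipWith _∧_ v (edge G e) U)

  incidence-minimallyUnsolvable : MinimalNonOddTransversal G → MinimallyUnsolvable (incidence G) 1ᵥ
  incidence-minimallyUnsolvable (¬transversal , transversal-without) = unsolvable , solvable-without
    where
    unsolvable : ¬ Solvable (incidence G) 1ᵥ
    unsolvable (x , sol) = ¬transversal (tabulate x , λ e → sum≡true⇒odd (edge G e ∩ tabulate x)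
      (trans (sum-edge∩ e (tabulate x)) (trans (·-congʳ _ (lookup∘tabulate x)) (sol e))))
    solvable-without : ∀ e → SolvableWithout (incidence G) 1ᵥ e
    solvable-without e with transversal-without e
    ... | U , odd = lookup U , λ i i≢e →
      trans (sym (sum-edge∩ i U)) (odd⇒sum≡true (edge G i ∩ U) (odd i i≢e))

  incidence-rows-even : (∀ e → Even ∣ edge G e ∣) → incidence G *ᵥ 1ᵥ ≗ 0ᵥ
  incidence-rows-even even e =
    trans (sum-cong-≗ (λ v → ∧-identityʳ (incidence G e v))) (even⇒sum≡false (edge G e) (even e))

1≤∣p∣⇒nonempty : (p : Subset n) → 1 ≤ ∣ p ∣ → Nonempty p
1≤∣p∣⇒nonempty (true  ∷ p) _      = zero , here
1≤∣p∣⇒nonempty (false ∷ p) 1≤∣p∣ = Product.map suc there (1≤∣p∣⇒nonempty p 1≤∣p∣)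

∣p∣<n⇒∃∉ : (p : Subset n) → ∣ p ∣ < n → ∃ λ x → x ∉ p
∣p∣<n⇒∃∉ p ∣p∣<n
  with 1≤∣p∣⇒nonempty (∁ p) (subst (1 ≤_) (sym (∣∁p∣≡n∸∣p∣ p)) (m<n⇒0<n∸m ∣p∣<n))
... | x , x∈∁p = x , x∈∁p⇒x∉p x∈∁p

∈-unionOf : (E : Fin m → Subset n) {S : Subset m} {i : Fin m} {x : Fin n} →
            i ∈ S → x ∈ E i → x ∈ unionOf E S
∈-unionOf E here        x∈Eᵢ = p⊆p∪q _ x∈Eᵢ
∈-unionOf E (there i∈S) x∈Eᵢ = q⊆p∪q _ _ (∈-unionOf (E ∘ suc) i∈S x∈Eᵢ)

injection⇒∣∣≤ : (S : Subset m) (T : Subset n) (f : ∀ i → lookup S i ≡ true → Fin n) →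
                (∀ i s → f i s ∈ T) → (∀ {i j} s t → f i s ≡ f j t → i ≡ j) → ∣ S ∣ ≤ ∣ T ∣
injection⇒∣∣≤ []          T f f∈T f-inj = z≤n
injection⇒∣∣≤ (false ∷ S) T f f∈T f-inj =
  injection⇒∣∣≤ S T (f ∘ suc) (f∈T ∘ suc) (λ s t → suc-injective ∘ f-inj s t)
injection⇒∣∣≤ {n = n} (true ∷ S) T f f∈T f-inj =
  ≤-trans (s≤s (injection⇒∣∣≤ S (T - x) (f ∘ suc) f∈T-x (λ s t → suc-injective ∘ f-inj s t)))
          (x∈p⇒∣p-x∣<∣p∣ (f∈T zero refl))
  where
  x : Fin n
  x = f zero refl
  f∈T-x : ∀ i s → f (suc i) s ∈ T - x
  f∈T-x i s = x∈p∧x≢y⇒x∈p-y (f∈T (suc i) s) (λ fᵢ≡x → 0≢1+n (f-inj refl s (sym fᵢ≡x)))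

module _ (G : Hypergraph n m) (minimal : MinimalNonOddTransversal G)
         (even : ∀ e → Even ∣ edge G e ∣) where

  avoiding-incidence-matching : {S : Vector Bool m} {e : Fin m} → S e ≡ false →
                                (u : Fin n) → Σ (Matching (incidence G) S) λ mt → Avoids mt u
  avoiding-incidence-matching =
    avoiding-matching (incidence-minimallyUnsolvable G minimal) (incidence-rows-even G even)

  union-grows : (S : Subset m) → 1 ≤ ∣ S ∣ → ∣ S ∣ < m → suc ∣ S ∣ ≤ ∣ unionOf (edge G) S ∣
  union-grows S 1≤∣S∣ ∣S∣<m with 1≤∣p∣⇒nonempty S 1≤∣S∣ | ∣p∣<n⇒∃∉ S ∣S∣<m
  ... | e₁ , e₁∈S | e₀ , e₀∉S with nonemptyE G e₁
  ... | u , u∈e₁ with avoiding-incidence-matching {S = lookup S} (¬-not (e₀∉S ∘ lookup⇒[]= e₀ S)) u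
  ... | mt , avoids =
    ≤-trans (s≤s (injection⇒∣∣≤ S (U - u) match match∈U-u match-injective))
            (x∈p⇒∣p-x∣<∣p∣ (∈-unionOf (edge G) e₁∈S u∈e₁))
    where
    open Matching mt
    U : Subset n
    U = unionOf (edge G) S
    match∈U-u : ∀ i s → match i s ∈ U - u
    match∈U-u i s =
      x∈p∧x≢y⇒x∈p-y (∈-unionOf (edge G) (lookup⇒[]= i S s) (lookup⇒[]= _ _ (match-∈ i s))) (avoids i s)

edge-matching : (G : Hypergraph n m) → MinimalNonOddTransversal G → (∀ e → Even ∣ edge G e ∣) →
                Matching (incidence G) 1ᵥ
edge-matching {m = zero}  G minimal even = empty-matching (λ ())
edge-matching {m = suc m} G minimal even with nonemptyE G zero
... | u , u∈e₀
  with avoiding-incidence-matching G minimal even {S = delete zero 1ᵥ} {e = zero} (delete-∉ {suc m} zero 1ᵥ) u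
... | mt , avoids = matching-insert ([]=⇒lookup u∈e₀) mt avoids

1≤m≤n∸1⇒m<n : ∀ {m n} → 1 ≤ m → m ≤ n ∸ 1 → m < n
1≤m≤n∸1⇒m<n {n = zero}  (s≤s _) ()
1≤m≤n∸1⇒m<n {n = suc n} _       m≤n = s≤s m≤n

corollary3p7 : ∀ {n m} (G : Hypergraph n m)
    → MinimalNonOddTransversal G
    → (∀ e → Even ∣ edge G e ∣)
    → (m ≤ n)
      × (∀ (t : ℕ) → 1 ≤ t → t ≤ m ∸ 1
           → ∀ (S : Subset m) → ∣ S ∣ ≡ t → suc t ≤ ∣ unionOf (edge G) S ∣)
      × (Σ (Fin m → Fin n) λ f → Injective _≡_ _≡_ f × (∀ e → f e ∈ edge G e))
corollary3p7 {n} {m} G minimal even =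
  injective⇒≤ f-injective , union-bound , f , f-injective , f∈edge
  where
  open Matching (edge-matching G minimal even)
  f : Fin m → Fin n
  f e = match e refl
  f-injective : Injective _≡_ _≡_ f
  f-injective = match-injective refl refl
  f∈edge : ∀ e → f e ∈ edge G e
  f∈edge e = lookup⇒[]= (f e) (edge G e) (match-∈ e refl)
  union-bound : ∀ t → 1 ≤ t → t ≤ m ∸ 1 → ∀ S → ∣ S ∣ ≡ t → suc t ≤ ∣ unionOf (edge G) S ∣
  union-bound t 1≤t t≤m∸1 S refl = union-grows G minimal even S 1≤t (1≤m≤n∸1⇒m<n 1≤t t≤m∸1)
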